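{- Let $t\ge2$ and let $n_1,\dots,n_t\ge3$. Let $G=Amal\{C_{n_i}\}_{i=1}^t$ be the vertex amalgamation of the cycles $C_{n_1},\dots,C_{n_t}$, and let $D$ be an orientation of $G$ in which each of the $t$ cycles is a directed cycle. Then the directed metric dimension of $D$ is $\dim(D)=t-1$.
   Context: The vertex amalgamation $Amal\{C_{n_i}\}_{i=1}^t$ is the graph obtained from disjoint cycles $C_{n_1},\dots,C_{n_t}$ by identifying one vertex of each cycle into a single common vertex (the terminal vertex). For a strongly connected oriented graph $D$, $d(u,v)$ is the minimum length of a directed path from $u$ to $v$; for a nonempty ordered set $B=\{b_1,\dots,b_k\}\subseteq V(D)$, $r(v|B)=(d(v,b_1),\dots,d(v,b_k))$; $B$ is resolving if distinct vertices have distinct representations; $\dim(D)$ is the minimum cardinality of a resolving set. -}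

module Defs where

open import Data.Nat using (ℕ; zero; suc; pred; _≤_)
open import Data.Fin using (Fin; toℕ; fromℕ; inject₁; zero; suc)
open import Data.Bool using (Bool; true; false; if_then_else_)
open import Data.Product using (Σ; _×_; _,_)
open import Relation.Binary.PropositionalEquality using (_≡_)
open import Function.Bundles using (_⇔_)
open import Function.Definitions using (Injective)
open import Level using (0ℓ)

module _ {V : Set} (Arc : V → V → Set) where

  record DPath (u v : V) (k : ℕ) : Set where
    field
      vert     : Fin (suc k) → V
      distinct : Injective _≡_ _≡_ vert
      start    : vert zero ≡ u
      end      : vert (fromℕ k) ≡ v
      arcs     : (j : Fin k) → Arc (vert (inject₁ j)) (vert (suc j))

  Dist : V → V → ℕ → Set
  Dist u v k = DPath u v k × ((m : ℕ) → DPath u v m → k ≤ m)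

  SameRep : {k : ℕ} → (Fin k → V) → V → V → Set
  SameRep B u v = (i : Fin _) (d : ℕ) → Dist u (B i) d ⇔ Dist v (B i) d

  Resolving : {k : ℕ} → (Fin k → V) → Set
  Resolving B = (u v : V) → SameRep B u v → u ≡ v

  MetricDim : ℕ → Set
  MetricDim k =
    (Σ (Fin k → V) λ B → Injective _≡_ _≡_ B × Resolving B)
    × ((m : ℕ) (B : Fin m → V) → Resolving B → k ≤ m)

-- The vertex amalgamation Amal{C_{n_i}}_{i=1}^t.
-- Cycle i consists of the common terminal vertex (position 0) and the
-- vertices  inner i j  (position j+1, for j < n_i - 1).

data AmalV (t : ℕ) (n : Fin t → ℕ) : Set where
  terminal : AmalV t n
  inner    : (i : Fin t) → Fin (pred (n i)) → AmalV t n

data CycArc {t : ℕ} {n : Fin t → ℕ} (i : Fin t) : AmalV t n → AmalV t n → Set where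
  out  : (j : Fin (pred (n i))) → toℕ j ≡ 0 → CycArc i terminal (inner i j)
  step : (j j′ : Fin (pred (n i))) → toℕ j′ ≡ suc (toℕ j) → CycArc i (inner i j) (inner i j′)
  back : (j : Fin (pred (n i))) → suc (toℕ j) ≡ pred (n i) → CycArc i (inner i j) terminal

-- An orientation of Amal{C_{n_i}} in which every cycle is a directed
-- cycle: cycle i is oriented in one of its two cyclic directions,
-- chosen by dir i.
AmalArc : {t : ℕ} (n : Fin t → ℕ) (dir : Fin t → Bool) → AmalV t n → AmalV t n → Set
AmalArc n dir u v = Σ (Fin _) λ i → if dir i then CycArc i u v else CycArc i v u

-- Every non-terminal vertex has exactly one out-neighbour and one in-neighbour, so distances
-- are forced along the cycles.  Let x_i be the last vertex of cycle i (the one with an arc into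
-- the terminal) and let the rank r of an inner vertex v of cycle i be its distance to x_i.  Then
-- d(v, x_i) = r, d(v, x_j) = r + 1 + d(terminal, x_j) for j ≠ i, and d(terminal, x_j) = n_j - 1.
-- Comparing d(·, x_j) with n_j - 1 tells whether a vertex lies on cycle j, is the terminal, or
-- lies on another cycle, so the last vertices of all cycles but one resolve D.  Conversely, two
-- last vertices share their unique out-neighbour, the terminal, and hence have equal distances
-- to every other vertex: a resolving set misses at most one of them.

module Submission where

open import Defs
open import Data.Bool using (Bool; true; false; if_then_else_)
open import Data.Empty using (⊥-elim)
open import Data.Fin using (Fin; zero; suc; toℕ; fromℕ; fromℕ<; inject₁; opposite)
  renaming (_≟_ to _≟ᶠ_)
open import Data.Fin.Properties
  using (toℕ-fromℕ; toℕ-fromℕ<; toℕ<n; toℕ-injective; opposite-prop; opposite-involutive;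
         any?; injective⇒≤)
  renaming (suc-injective to suc-injectiveᶠ)
open import Data.Fin.Relation.Unary.Top using (view; ‵fromℕ; ‵inject₁)
open import Data.Nat using (ℕ; zero; suc; pred; _+_; _∸_; _≤_; _<_; s≤s; s≤s⁻¹; z≤n; >-nonZero)
open import Data.Nat.Properties
  using (suc-injective; 0≢1+n; n∸n≡0; +-∸-assoc; <-irrefl; ≤-antisym; ≤-trans; m≤n+m; m<m+n;
         +-suc; +-identityʳ; +-cancelʳ-≡; m≢1+n+m; suc-pred; m≤n+o⇒m∸n≤o; pred-mono-≤; n≤1+n)
open import Data.Product using (Σ; ∃; _×_; _,_; proj₁; proj₂)
open import Data.Sum using (_⊎_; inj₁; inj₂; [_,_]′)
open import Function using (id; flip; _∘_)
open import Function.Bundles using (mk⇔; Equivalence)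
open import Function.Definitions using (Injective)
open import Relation.Binary.Definitions using (DecidableEquality)
open import Relation.Binary.PropositionalEquality
open import Relation.Nullary using (¬_; Dec; yes; no)
open import Relation.Nullary.Decidable using (map′)

opposite-fromℕ : ∀ k → opposite (fromℕ k) ≡ zero
opposite-fromℕ zero    = refl
opposite-fromℕ (suc k) = cong inject₁ (opposite-fromℕ k)

opposite-inject₁ : ∀ {k} (j : Fin k) → opposite (inject₁ j) ≡ suc (opposite j)
opposite-inject₁ {suc k} zero    = refl
opposite-inject₁ {suc k} (suc j) = cong inject₁ (opposite-inject₁ j)

opposite-injective : ∀ {k} → Injective _≡_ _≡_ (opposite {k})
opposite-injective {x = i} {j} e =
  trans (sym (opposite-involutive i)) (trans (cong opposite e) (opposite-involutive j))

reverse : ∀ {V : Set} {Arc : V → V → Set} {u v k} → DPath Arc u v k → DPath (flip Arc) v u k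
reverse {Arc = Arc} {k = k} P = record
  { vert     = vert ∘ opposite
  ; distinct = opposite-injective ∘ distinct
  ; start    = end
  ; end      = trans (cong vert (opposite-fromℕ k)) start
  ; arcs     = λ j → subst (Arc (vert (inject₁ (opposite j))) ∘ vert)
                           (sym (opposite-inject₁ j)) (arcs (opposite j))
  }
  where open DPath P

dist-reverse : ∀ {V : Set} {Arc : V → V → Set} {u v d} → Dist Arc u v d → Dist (flip Arc) v u d
dist-reverse (P , minimal) = reverse P , λ m Q → minimal m (reverse Q)

module _ {V : Set} (Arc : V → V → Set) where
  open DPath

  UniqueSuccessor : V → V → Set
  UniqueSuccessor u w = Arc u w × (∀ w′ → Arc u w′ → w′ ≡ w)

  dist-refl : ∀ u → Dist Arc u u 0
  dist-refl u = record { vert = λ _ → u ; distinct = λ { {zero} {zero} _ → refl }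
                       ; start = refl ; end = refl ; arcs = λ () }
              , λ _ _ → z≤n

  path-length-0 : ∀ {u b} → DPath Arc u b 0 → u ≡ b
  path-length-0 P = trans (sym (start P)) (end P)

  dist-unique : ∀ {u b d d′} → Dist Arc u b d → Dist Arc u b d′ → d ≡ d′
  dist-unique (P , minimal) (P′ , minimal′) = ≤-antisym (minimal _ P′) (minimal′ _ P)

  uncons : ∀ {u b d} → DPath Arc u b (suc d) → Σ V λ w → Arc u w × DPath Arc w b d
  uncons P = vert P (suc zero)
           , subst (λ z → Arc z (vert P (suc zero))) (start P) (arcs P zero)
           , record { vert = vert P ∘ suc ; distinct = suc-injectiveᶠ ∘ distinct P
                    ; start = refl ; end = end P ; arcs = arcs P ∘ suc }

  prepend : ∀ {u w b d} → Arc u w → (P : DPath Arc w b d) → (∀ j → vert P j ≢ u) →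
            DPath Arc u b (suc d)
  prepend {u} {w} {b} {d} a P avoids = record
    { vert = vert′ ; distinct = distinct′ ; start = refl ; end = end P ; arcs = arcs′ }
    where
    vert′ : Fin (suc (suc d)) → V
    vert′ zero    = u
    vert′ (suc j) = vert P j
    distinct′ : Injective _≡_ _≡_ vert′
    distinct′ {zero}  {zero}  _ = refl
    distinct′ {zero}  {suc y} e = ⊥-elim (avoids y (sym e))
    distinct′ {suc x} {zero}  e = ⊥-elim (avoids x e)
    distinct′ {suc x} {suc y} e = cong suc (distinct P e)
    arcs′ : (j : Fin (suc d)) → Arc (vert′ (inject₁ j)) (vert′ (suc j))
    arcs′ zero    = subst (Arc u) (sym (start P)) a
    arcs′ (suc j) = arcs P j

  -- If u occurred on P, the vertex after it would be u's successor w = vert P zero.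
  uniqueSuccessor-avoids : ∀ {u w b d} → UniqueSuccessor u w → u ≢ b →
                           (P : DPath Arc w b d) → ∀ j → vert P j ≢ u
  uniqueSuccessor-avoids _ u≢b P j e with view j
  ... | ‵fromℕ     = u≢b (trans (sym e) (end P))
  uniqueSuccessor-avoids (_ , unique) u≢b P j e | ‵inject₁ j′
    with distinct P (trans (unique _ (subst (λ z → Arc z _) e (arcs P j′))) (sym (start P)))
  ... | ()

  dist-suc : ∀ {u w b d} → UniqueSuccessor u w → u ≢ b → Dist Arc w b d → Dist Arc u b (suc d)
  dist-suc {u} {w} {b} {d} succ u≢b (P , minimal) =
    prepend (proj₁ succ) P (uniqueSuccessor-avoids succ u≢b P) , minimal′
    where
    minimal′ : (m : ℕ) → DPath Arc u b m → suc d ≤ m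
    minimal′ zero    Q = ⊥-elim (u≢b (path-length-0 Q))
    minimal′ (suc m) Q with uncons Q
    ... | w′ , a , Q′ with proj₂ succ w′ a
    ... | refl = s≤s (minimal m Q′)

  dist-suc⁻¹ : ∀ {u w b d} → UniqueSuccessor u w → u ≢ b → Dist Arc u b (suc d) → Dist Arc w b d
  dist-suc⁻¹ succ u≢b (P , minimal) with uncons P
  ... | w′ , a , P′ with proj₂ succ w′ a
  ... | refl = P′ , λ m Q →
    s≤s⁻¹ (minimal (suc m) (prepend a Q (uniqueSuccessor-avoids succ u≢b Q)))

  dist-sharedSuccessor : ∀ {u v w b d} → UniqueSuccessor u w → UniqueSuccessor v w →
                         u ≢ b → v ≢ b → Dist Arc u b d → Dist Arc v b d
  dist-sharedSuccessor {d = zero}  _     _     u≢b _   (P , _) = ⊥-elim (u≢b (path-length-0 P))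
  dist-sharedSuccessor {d = suc d} succᵤ succᵥ u≢b v≢b D =
    dist-suc succᵥ v≢b (dist-suc⁻¹ succᵤ u≢b D)

  sharedSuccessor⇒sameRep : ∀ {k} {B : Fin k → V} {u v w} →
                            UniqueSuccessor u w → UniqueSuccessor v w →
                            (∀ i → B i ≢ u) → (∀ i → B i ≢ v) → SameRep Arc B u v
  sharedSuccessor⇒sameRep succᵤ succᵥ u∉B v∉B i d =
    mk⇔ (dist-sharedSuccessor succᵤ succᵥ (u∉B i ∘ sym) (v∉B i ∘ sym))
        (dist-sharedSuccessor succᵥ succᵤ (v∉B i ∘ sym) (u∉B i ∘ sym))

  sameRep-sym : ∀ {k} {B : Fin k → V} {u v} → SameRep Arc B u v → SameRep Arc B v u
  sameRep-sym same i d = mk⇔ (Equivalence.from (same i d)) (Equivalence.to (same i d))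

  sameRep-dist : ∀ {k} {B : Fin k → V} {u v d d′} → SameRep Arc B u v →
                 ∀ i → Dist Arc u (B i) d → Dist Arc v (B i) d′ → d ≡ d′
  sameRep-dist same i Dᵤ Dᵥ = dist-unique (Equivalence.to (same i _) Dᵤ) Dᵥ

dist-predecessor : ∀ {V : Set} {Arc : V → V → Set} {u y b d} →
                   UniqueSuccessor (flip Arc) b y → u ≢ b → Dist Arc u y d → Dist Arc u b (suc d)
dist-predecessor {Arc = Arc} predecessor u≢b D =
  dist-reverse (dist-suc (flip Arc) predecessor (u≢b ∘ sym) (dist-reverse D))

module _ {n : ℕ} where

  opposite-first : {i : Fin n} → toℕ i ≡ 0 → suc (toℕ (opposite i)) ≡ n
  opposite-first {i = zero} _ = cong suc (toℕ-fromℕ _)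

  opposite-last : {i : Fin n} → suc (toℕ i) ≡ n → toℕ (opposite i) ≡ 0
  opposite-last {i} e = trans (opposite-prop i) (trans (cong (n ∸_) e) (n∸n≡0 n))

  opposite-successor : {i j : Fin n} → toℕ j ≡ suc (toℕ i) →
                       toℕ (opposite i) ≡ suc (toℕ (opposite j))
  opposite-successor {i} {j} e = begin
    toℕ (opposite i)       ≡⟨ opposite-prop i ⟩
    n ∸ suc (toℕ i)        ≡⟨ cong (n ∸_) e ⟨
    n ∸ toℕ j              ≡⟨ +-∸-assoc 1 (toℕ<n j) ⟩
    suc (n ∸ suc (toℕ j))  ≡⟨ cong suc (opposite-prop j) ⟨
    suc (toℕ (opposite j)) ∎
    where open ≡-Reasoning

  opposite-first⁻¹ : {i : Fin n} → suc (toℕ (opposite i)) ≡ n → toℕ i ≡ 0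
  opposite-first⁻¹ {i} e = subst (λ k → toℕ k ≡ 0) (opposite-involutive i) (opposite-last e)

  opposite-last⁻¹ : {i : Fin n} → toℕ (opposite i) ≡ 0 → suc (toℕ i) ≡ n
  opposite-last⁻¹ {i} e = subst (λ k → suc (toℕ k) ≡ n) (opposite-involutive i) (opposite-first e)

  opposite-successor⁻¹ : {i j : Fin n} → toℕ (opposite i) ≡ suc (toℕ (opposite j)) →
                         toℕ j ≡ suc (toℕ i)
  opposite-successor⁻¹ {i} {j} e = subst₂ (λ k l → toℕ k ≡ suc (toℕ l))
    (opposite-involutive j) (opposite-involutive i) (opposite-successor e)

module _ {A : Set} (_≟_ : DecidableEquality A) {t m : ℕ}
         (x : Fin t → A) (x-injective : Injective _≡_ _≡_ x) (B : Fin m → A) where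

  private
    position : {a : A} → Dec (∃ λ k → B k ≡ a) → Fin (suc m)
    position (yes (k , _)) = suc k
    position (no _)        = zero

  missesAtMostOne⇒≤suc : (∀ i j → i ≢ j → (∃ λ k → B k ≡ x i) ⊎ (∃ λ k → B k ≡ x j)) →
                         t ≤ suc m
  missesAtMostOne⇒≤suc missesAtMostOne = injective⇒≤ injective
    where
    injective : Injective _≡_ _≡_ (λ i → position (any? λ k → B k ≟ x i))
    injective {i} {j} e with any? (λ k → B k ≟ x i) | any? (λ k → B k ≟ x j)
    ... | yes (k , Bk≡xi) | yes (k′ , Bk′≡xj) =
      x-injective (trans (sym Bk≡xi) (trans (cong B (suc-injectiveᶠ e)) Bk′≡xj))
    ... | no xi∉B | no xj∉B with i ≟ᶠ j
    ...   | yes i≡j = i≡j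
    ...   | no i≢j  = ⊥-elim ([ xi∉B , xj∉B ]′ (missesAtMostOne i j i≢j))

module Amalgamation {t : ℕ} (n : Fin t → ℕ) (dir : Fin t → Bool) where

  V : Set
  V = AmalV t n

  Arc : V → V → Set
  Arc = AmalArc n dir

  N : Fin t → ℕ
  N i = pred (n i)

  inner-injective : ∀ {i a b} → inner {t} {n} i a ≡ inner i b → a ≡ b
  inner-injective refl = refl

  inner-cycle : ∀ {i j a b} → inner {t} {n} i a ≡ inner j b → i ≡ j
  inner-cycle refl = refl

  _≟_ : DecidableEquality V
  terminal  ≟ terminal  = yes refl
  terminal  ≟ inner _ _ = no λ ()
  inner _ _ ≟ terminal  = no λ ()
  inner i a ≟ inner j b with i ≟ᶠ j
  ... | no i≢j  = no (i≢j ∘ inner-cycle)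
  ... | yes refl = map′ (cong (inner i)) inner-injective (a ≟ᶠ b)

  relabelBy : ∀ {k} → Bool → Fin k → Fin k
  relabelBy true  = opposite
  relabelBy false = id

  relabelBy-involutive : ∀ {k} b (a : Fin k) → relabelBy b (relabelBy b a) ≡ a
  relabelBy-involutive true  = opposite-involutive
  relabelBy-involutive false _ = refl

  -- rank i a is the distance from inner i a to the last vertex of cycle i.
  rank : (i : Fin t) → Fin (N i) → ℕ
  rank i a = toℕ (relabelBy (dir i) a)

  rank-forward : ∀ {i} a → dir i ≡ true → rank i a ≡ toℕ (opposite a)
  rank-forward a e = cong (λ b → toℕ (relabelBy b a)) e

  rank-backward : ∀ {i} a → dir i ≡ false → rank i a ≡ toℕ a
  rank-backward a e = cong (λ b → toℕ (relabelBy b a)) e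

  rank<N : ∀ i a → rank i a < N i
  rank<N i a = toℕ<n (relabelBy (dir i) a)

  rank-injective : ∀ {i a b} → rank i a ≡ rank i b → a ≡ b
  rank-injective {i} {a} {b} e = begin
    a                                       ≡⟨ relabelBy-involutive (dir i) a ⟨
    relabelBy (dir i) (relabelBy (dir i) a) ≡⟨ cong (relabelBy (dir i)) (toℕ-injective e) ⟩
    relabelBy (dir i) (relabelBy (dir i) b) ≡⟨ relabelBy-involutive (dir i) b ⟩
    b                                       ∎
    where open ≡-Reasoning

  ofRank : ∀ i {r} → r < N i → Fin (N i)
  ofRank i r<N = relabelBy (dir i) (fromℕ< r<N)

  rank-ofRank : ∀ i {r} (r<N : r < N i) → rank i (ofRank i r<N) ≡ r
  rank-ofRank i r<N = trans (cong toℕ (relabelBy-involutive (dir i) _)) (toℕ-fromℕ< r<N)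

  data RankArc : V → V → Set where
    leave   : ∀ {i a}   → rank i a ≡ 0 → RankArc (inner i a) terminal
    descend : ∀ {i a b} → rank i a ≡ suc (rank i b) → RankArc (inner i a) (inner i b)
    enter   : ∀ {i a}   → suc (rank i a) ≡ N i → RankArc terminal (inner i a)

  forwardArc : ∀ {i u v} → dir i ≡ true → CycArc i u v → Arc u v
  forwardArc {i} {u} {v} e c = i , subst (λ b → if b then CycArc i u v else CycArc i v u) (sym e) c

  backwardArc : ∀ {i u v} → dir i ≡ false → CycArc i v u → Arc u v
  backwardArc {i} {u} {v} e c = i , subst (λ b → if b then CycArc i u v else CycArc i v u) (sym e) c

  arc⇒rankArc : ∀ {u v} → Arc u v → RankArc u v
  arc⇒rankArc (i , c) with dir i in e
  arc⇒rankArc (i , out a a≡0)      | true  =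
    enter (trans (cong suc (rank-forward a e)) (opposite-first a≡0))
  arc⇒rankArc (i , step a b b≡1+a) | true  =
    descend (trans (rank-forward a e) (trans (opposite-successor b≡1+a) (cong suc (sym (rank-forward b e)))))
  arc⇒rankArc (i , back a 1+a≡N)   | true  =
    leave (trans (rank-forward a e) (opposite-last 1+a≡N))
  arc⇒rankArc (i , out a a≡0)      | false =
    leave (trans (rank-backward a e) a≡0)
  arc⇒rankArc (i , step a b b≡1+a) | false =
    descend (trans (rank-backward b e) (trans b≡1+a (cong suc (sym (rank-backward a e)))))
  arc⇒rankArc (i , back a 1+a≡N)   | false =
    enter (trans (cong suc (rank-backward a e)) 1+a≡N)

  rankArc⇒arc : ∀ {u v} → RankArc u v → Arc u v
  rankArc⇒arc (leave {i} {a} r≡0) with dir i in e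
  ... | true  = forwardArc e (back a (opposite-last⁻¹ r≡0))
  ... | false = backwardArc e (out a r≡0)
  rankArc⇒arc (descend {i} {a} {b} r≡1+r) with dir i in e
  ... | true  = forwardArc e (step a b (opposite-successor⁻¹ r≡1+r))
  ... | false = backwardArc e (step b a r≡1+r)
  rankArc⇒arc (enter {i} {a} 1+r≡N) with dir i in e
  ... | true  = forwardArc e (out a (opposite-first⁻¹ 1+r≡N))
  ... | false = backwardArc e (back a 1+r≡N)

  rankArc-functional : ∀ {i a v w} → RankArc (inner i a) v → RankArc (inner i a) w → v ≡ w
  rankArc-functional (leave _)        (leave _)        = refl
  rankArc-functional (leave r≡0)      (descend r≡1+r′) = ⊥-elim (0≢1+n (trans (sym r≡0) r≡1+r′))
  rankArc-functional (descend r≡1+r′) (leave r≡0)      = ⊥-elim (0≢1+n (trans (sym r≡0) r≡1+r′))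
  rankArc-functional (descend r≡1+r′) (descend r≡1+r″) =
    cong (inner _) (rank-injective (suc-injective (trans (sym r≡1+r′) r≡1+r″)))

  rankArc-injective : ∀ {i a v w} → RankArc v (inner i a) → RankArc w (inner i a) → v ≡ w
  rankArc-injective (enter _) (enter _) = refl
  rankArc-injective (enter 1+r≡N) (descend {a = b} r′≡1+r) =
    ⊥-elim (<-irrefl (trans r′≡1+r 1+r≡N) (rank<N _ b))
  rankArc-injective (descend {a = b} r′≡1+r) (enter 1+r≡N) =
    ⊥-elim (<-irrefl (trans r′≡1+r 1+r≡N) (rank<N _ b))
  rankArc-injective (descend r′≡1+r) (descend r″≡1+r) =
    cong (inner _) (rank-injective (trans r′≡1+r (sym r″≡1+r)))

  rankArc⇒uniqueSuccessor : ∀ {i a w} → RankArc (inner i a) w → UniqueSuccessor Arc (inner i a) w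
  rankArc⇒uniqueSuccessor r = rankArc⇒arc r , λ _ a → rankArc-functional (arc⇒rankArc a) r

  rankArc⇒uniquePredecessor : ∀ {i a w} → RankArc w (inner i a) →
                              UniqueSuccessor (flip Arc) (inner i a) w
  rankArc⇒uniquePredecessor r = rankArc⇒arc r , λ _ a → rankArc-injective (arc⇒rankArc a) r

  successor-rank-suc : ∀ {i a r} → rank i a ≡ suc r →
                       Σ (Fin (N i)) λ b → rank i b ≡ r × UniqueSuccessor Arc (inner i a) (inner i b)
  successor-rank-suc {i} {a} r≡ =
    ofRank i r<N , rank-ofRank i r<N ,
    rankArc⇒uniqueSuccessor (descend (trans r≡ (cong suc (sym (rank-ofRank i r<N)))))
    where
    r<N : _ < N i
    r<N = ≤-trans (s≤s (m≤n+m _ 1)) (subst (_< N i) r≡ (rank<N i a))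

  predecessor-below-top : ∀ {i a} → suc (rank i a) < N i →
                          Σ (Fin (N i)) λ b → rank i b ≡ suc (rank i a) ×
                                              UniqueSuccessor (flip Arc) (inner i a) (inner i b)
  predecessor-below-top {i} 1+r<N =
    ofRank i 1+r<N , rank-ofRank i 1+r<N , rankArc⇒uniquePredecessor (descend (rank-ofRank i 1+r<N))

  dist-through-terminal : ∀ {i b d} r a → rank i a ≡ r → (∀ c → inner i c ≢ b) →
                          Dist Arc terminal b d → Dist Arc (inner i a) b (suc r + d)
  dist-through-terminal zero a r≡0 off D =
    dist-suc Arc (rankArc⇒uniqueSuccessor (leave r≡0)) (off a) D
  dist-through-terminal (suc r) a r≡ off D with successor-rank-suc r≡
  ... | b , rb≡r , succ = dist-suc Arc succ (off a) (dist-through-terminal r b rb≡r off D)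

  dist-from-terminal : ∀ {i} m a → suc (rank i a) + m ≡ N i → Dist Arc terminal (inner i a) (suc m)
  dist-from-terminal zero a e = dist-predecessor
    (rankArc⇒uniquePredecessor (enter (trans (sym (+-identityʳ _)) e))) (λ ()) (dist-refl Arc terminal)
  dist-from-terminal {i} (suc m) a e
    with predecessor-below-top (subst (suc (rank i a) <_) e (m<m+n (suc (rank i a)) (s≤s z≤n)))
  ... | b , rb≡ , predecessor = dist-predecessor predecessor (λ ())
    (dist-from-terminal m b (trans (cong (λ r → suc r + m) rb≡) (trans (sym (+-suc _ m)) e)))

  module LastVertices (nontrivial : ∀ i → 2 ≤ n i) where

    0<N : ∀ i → 0 < N i
    0<N i = pred-mono-≤ (nontrivial i)

    lastIndex : (i : Fin t) → Fin (N i)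
    lastIndex i = ofRank i (0<N i)

    lastVertex : Fin t → V
    lastVertex i = inner i (lastIndex i)

    lastVertex-injective : Injective _≡_ _≡_ lastVertex
    lastVertex-injective = inner-cycle

    rank-last : ∀ i → rank i (lastIndex i) ≡ 0
    rank-last i = rank-ofRank i (0<N i)

    lastVertex-successor : ∀ i → UniqueSuccessor Arc (lastVertex i) terminal
    lastVertex-successor i = rankArc⇒uniqueSuccessor (leave (rank-last i))

    dist-own-last : ∀ i a → Dist Arc (inner i a) (lastVertex i) (rank i a)
    dist-own-last i a = go (rank i a) a refl
      where
      go : ∀ r a → rank i a ≡ r → Dist Arc (inner i a) (lastVertex i) r
      go zero a r≡0 = subst (λ b → Dist Arc (inner i b) (lastVertex i) 0)
                            (rank-injective (trans (rank-last i) (sym r≡0))) (dist-refl Arc _)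
      go (suc r) a r≡ with successor-rank-suc r≡
      ... | b , rb≡r , succ = dist-suc Arc succ not-last (go r b rb≡r)
        where
        not-last : inner i a ≢ lastVertex i
        not-last e =
          0≢1+n (trans (sym (rank-last i)) (trans (cong (rank i) (sym (inner-injective e))) r≡))

    dist-terminal-last : ∀ i → Dist Arc terminal (lastVertex i) (N i)
    dist-terminal-last i = subst (Dist Arc terminal (lastVertex i)) 1+[N-1]≡N
      (dist-from-terminal (pred (N i)) (lastIndex i)
        (trans (cong (λ r → suc r + pred (N i)) (rank-last i)) 1+[N-1]≡N))
      where
      1+[N-1]≡N : suc (pred (N i)) ≡ N i
      1+[N-1]≡N = suc-pred (N i) {{>-nonZero (0<N i)}}

    dist-other-last : ∀ {i j} a → i ≢ j →
                      Dist Arc (inner i a) (lastVertex j) (suc (rank i a) + N j)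
    dist-other-last {i} {j} a i≢j =
      dist-through-terminal _ a refl (λ _ → i≢j ∘ inner-cycle) (dist-terminal-last j)

    resolving⇒t≤1+m : ∀ {m} (B : Fin m → V) → Resolving Arc B → t ≤ suc m
    resolving⇒t≤1+m B resolving =
      missesAtMostOne⇒≤suc _≟_ lastVertex lastVertex-injective B missesAtMostOne
      where
      missesAtMostOne : ∀ i j → i ≢ j →
                        (∃ λ k → B k ≡ lastVertex i) ⊎ (∃ λ k → B k ≡ lastVertex j)
      missesAtMostOne i j i≢j with any? (λ k → B k ≟ lastVertex i) | any? (λ k → B k ≟ lastVertex j)
      ... | yes hit | _       = inj₁ hit
      ... | no _    | yes hit = inj₂ hit
      ... | no miss | no miss′ = ⊥-elim (i≢j (lastVertex-injective (resolving _ _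
              (sharedSuccessor⇒sameRep Arc (lastVertex-successor i) (lastVertex-successor j)
                                            (λ k e → miss (k , e)) (λ k e → miss′ (k , e))))))

module Landmarks {s : ℕ} (n : Fin (suc (suc s)) → ℕ) (dir : Fin (suc (suc s)) → Bool)
                 (nontrivial : ∀ i → 2 ≤ n i) where
  open Amalgamation n dir
  open LastVertices nontrivial

  landmarks : Fin (suc s) → V
  landmarks k = lastVertex (suc k)

  landmarks-injective : Injective _≡_ _≡_ landmarks
  landmarks-injective = suc-injectiveᶠ ∘ lastVertex-injective

  0≢1 : _≢_ {A = Fin (suc (suc s))} zero (suc zero)
  0≢1 ()

  terminal-resolved : ∀ i a → ¬ SameRep Arc landmarks terminal (inner i a)
  terminal-resolved zero a same =
    m≢1+n+m (N (suc zero)) (sameRep-dist Arc same zero (dist-terminal-last _) (dist-other-last a 0≢1))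
  terminal-resolved (suc k) a same =
    <-irrefl (sym (sameRep-dist Arc same k (dist-terminal-last _) (dist-own-last _ a))) (rank<N _ a)

  other-cycle-resolved : ∀ k a j b → suc k ≢ j → ¬ SameRep Arc landmarks (inner (suc k) a) (inner j b)
  other-cycle-resolved k a j b k≢j same =
    <-irrefl refl (≤-trans (rank<N _ a) (subst (N (suc k) ≤_) (sym r≡) (m≤n+m _ _)))
    where
    r≡ : rank (suc k) a ≡ suc (rank j b) + N (suc k)
    r≡ = sameRep-dist Arc same k (dist-own-last _ a) (dist-other-last b (k≢j ∘ sym))

  distinct-cycles-resolved : ∀ {i j} a b → i ≢ j → ¬ SameRep Arc landmarks (inner i a) (inner j b)
  distinct-cycles-resolved {zero}  {zero}  _ _ i≢j = ⊥-elim (i≢j refl)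
  distinct-cycles-resolved {zero}  {suc k} a b i≢j =
    other-cycle-resolved k b zero a (i≢j ∘ sym) ∘ sameRep-sym Arc
  distinct-cycles-resolved {suc k} {j}     a b i≢j = other-cycle-resolved k a j b i≢j

  same-cycle-rank : ∀ i a b → SameRep Arc landmarks (inner i a) (inner i b) → rank i a ≡ rank i b
  same-cycle-rank zero a b same = suc-injective (+-cancelʳ-≡ _ _ _
    (sameRep-dist Arc same zero (dist-other-last a 0≢1) (dist-other-last b 0≢1)))
  same-cycle-rank (suc k) a b same = sameRep-dist Arc same k (dist-own-last _ a) (dist-own-last _ b)

  landmarks-resolving : Resolving Arc landmarks
  landmarks-resolving terminal    terminal    _    = refl
  landmarks-resolving terminal    (inner i a) same = ⊥-elim (terminal-resolved i a same)
  landmarks-resolving (inner i a) terminal    same =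
    ⊥-elim (terminal-resolved i a (sameRep-sym Arc same))
  landmarks-resolving (inner i a) (inner j b) same with i ≟ᶠ j
  ... | yes refl = cong (inner i) (rank-injective (same-cycle-rank i a b same))
  ... | no i≢j   = ⊥-elim (distinct-cycles-resolved a b i≢j same)

mainTheorem7 : (t : ℕ) → 2 ≤ t → (n : Fin t → ℕ) → ((i : Fin t) → 3 ≤ n i)
    → (dir : Fin t → Bool)
    → MetricDim (AmalArc n dir) (t ∸ 1)
mainTheorem7 (suc (suc s)) (s≤s (s≤s z≤n)) n 3≤n dir =
    (landmarks , landmarks-injective , landmarks-resolving)
  , λ m B resolving → m≤n+o⇒m∸n≤o (suc (suc s)) 1 (resolving⇒t≤1+m B resolving)
  where
  nontrivial : ∀ i → 2 ≤ n i
  nontrivial i = ≤-trans (n≤1+n 2) (3≤n i)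
  open Amalgamation n dir
  open LastVertices nontrivial
  open Landmarks n dir nontrivial
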